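{- Let $\mathcal{M}^c=\langle S^c,N^c,V^c\rangle$ be the canonical model for $(\mathbf{EMN})^\Delta$. Then $\mathcal{M}^c$ possesses property $(n)$: $S^c\in N^c(s)$ for every $s\in S^c$. Consequently its supplementation $(\mathcal{M}^c)^+$ also possesses property $(n)$.
   Context: $\mathcal{L}(\Delta)$: $\phi::=p\mid\neg\phi\mid\phi\land\phi\mid\Delta\phi$, $p$ in a countable set $\mathbf{P}$; $\top$ a fixed tautology. $(\mathbf{EMN})^\Delta$ is axiomatized by all propositional tautologies, $\Delta\phi\leftrightarrow\Delta\neg\phi$, $\Delta\phi\to\Delta(\phi\vee\psi)\vee\Delta(\neg\phi\vee\chi)$, $\Delta\top$, modus ponens, and RE$\Delta$ (from $\phi\leftrightarrow\psi$ infer $\Delta\phi\leftrightarrow\Delta\psi$). Canonical model: $S^c$ = maximal $(\mathbf{EMN})^\Delta$-consistent sets; $|\phi|=\{s\in S^c\mid\phi\in s\}$; $N^c(s)=\{|\phi|\mid\Delta(\phi\vee\psi)\in s\text{ for every formula }\psi\}$; $V^c(p)=|p|$. Supplementation: $(N^c)^+(s)=\{X\subseteq S^c\mid Y\subseteq X\text{ for some }Y\in N^c(s)\}$. -}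

module Defs where

open import Data.Nat using (ℕ)
open import Data.Bool using (Bool; true; false; not; _∧_)
open import Data.List using (List; []; _∷_)
open import Data.List.Relation.Unary.All using (All)
open import Data.Product using (Σ; _×_; _,_)
open import Data.Empty using (⊥)
open import Data.Unit using () renaming (⊤ to Unit)
open import Relation.Binary.PropositionalEquality using (_≡_)
open import Relation.Nullary using (¬_)
open import Function.Bundles using (_⇔_)
open import Level using (Level; suc)

data Form : Set where
  var : ℕ → Form
  ~_  : Form → Form
  _∧'_ : Form → Form → Form
  Δ   : Form → Form

infixr 6 _∧'_
infixr 5 _∨'_
infixr 4 _⇒_ _⇔'_
infix 7 ~_

_∨'_ : Form → Form → Form
φ ∨' ψ = ~ (~ φ ∧' ~ ψ)

_⇒_ : Form → Form → Form
φ ⇒ ψ = ~ (φ ∧' ~ ψ)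

_⇔'_ : Form → Form → Form
φ ⇔' ψ = (φ ⇒ ψ) ∧' (ψ ⇒ φ)

⊤' : Form
⊤' = ~ (var 0 ∧' ~ var 0)

-- Propositional tautologies: true under every Boolean assignment to the
-- propositional letters and to the Δ-formulas (treated as atoms).

eval : (Form → Bool) → Form → Bool
eval v (var p)  = v (var p)
eval v (~ φ)    = not (eval v φ)
eval v (φ ∧' ψ) = eval v φ ∧ eval v ψ
eval v (Δ φ)    = v (Δ φ)

Tautology : Form → Set
Tautology φ = (v : Form → Bool) → eval v φ ≡ true

data ⊢_ : Form → Set where
  taut : ∀ {φ} → Tautology φ → ⊢ φ
  axΔ¬ : ∀ φ → ⊢ (Δ φ ⇔' Δ (~ φ))
  axM  : ∀ φ ψ χ → ⊢ (Δ φ ⇒ (Δ (φ ∨' ψ) ∨' Δ (~ φ ∨' χ)))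
  axN  : ⊢ Δ ⊤'
  mp   : ∀ {φ ψ} → ⊢ (φ ⇒ ψ) → ⊢ φ → ⊢ ψ
  reΔ  : ∀ {φ ψ} → ⊢ (φ ⇔' ψ) → ⊢ (Δ φ ⇔' Δ ψ)

infix 3 ⊢_

FSet : Set₁
FSet = Form → Set

conj : List Form → Form
conj []       = ⊤'
conj (φ ∷ φs) = φ ∧' conj φs

Consistent : FSet → Set
Consistent Γ = ¬ (Σ (List Form) λ φs → All Γ φs × (⊢ ~ conj φs))

_⊆F_ : FSet → FSet → Set
Γ ⊆F Γ' = ∀ φ → Γ φ → Γ' φ

MaxCons : FSet → Set₁
MaxCons Γ = Consistent Γ × ((Γ' : FSet) → Γ ⊆F Γ' → Consistent Γ' → Γ' ⊆F Γ)

-- Neighbourhood models (subsets as predicates, compared extensionally)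

record NbhdModel : Set₂ where
  field
    S : Set₁
    N : S → (S → Set) → Set₁
    V : ℕ → S → Set

_≐_ : {S : Set₁} → (S → Set) → (S → Set) → Set₁
X ≐ Y = ∀ s → X s ⇔ Y s

HasPropertyN : NbhdModel → Set₁
HasPropertyN M = ∀ s → N s (λ _ → Unit)
  where open NbhdModel M

supplementation : NbhdModel → NbhdModel
supplementation M = record
  { S = S
  ; N = λ s X → Σ (S → Set) λ Y → N s Y × (∀ t → Y t → X t)
  ; V = V }
  where open NbhdModel M

Sᶜ : Set₁
Sᶜ = Σ FSet MaxCons

∣_∣ : Form → Sᶜ → Set
∣ φ ∣ (Γ , _) = Γ φ

Nᶜ : Sᶜ → (Sᶜ → Set) → Set₁
Nᶜ (Γ , m) X = Σ Form λ φ → (X ≐ ∣ φ ∣) × (∀ ψ → Γ (Δ (φ ∨' ψ)))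

Vᶜ : ℕ → Sᶜ → Set
Vᶜ p = ∣ var p ∣

canonicalModel : NbhdModel
canonicalModel = record { S = Sᶜ ; N = Nᶜ ; V = Vᶜ }

-- Δ⊤ is an axiom, and ⊤ ∨ ψ is provably equivalent to ⊤, so by RE Δ every
-- Δ(⊤ ∨ ψ) is a theorem and hence lies in every maximal consistent set; since
-- ⊤ does too, |⊤| is the whole of Sᶜ and belongs to every Nᶜ(s). Supplementation
-- only enlarges neighbourhoods, so it preserves property (n).
module Submission where

open import Defs
open import Data.Product using (_×_; _,_; Σ)
open import Data.Sum using (_⊎_; inj₁; inj₂)
open import Data.Bool using (true; false)
open import Data.List using (List; []; _∷_)
open import Data.List.Relation.Unary.All using (All; []; _∷_)
open import Data.Unit using () renaming (⊤ to Unit; tt to unit)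
open import Relation.Binary.PropositionalEquality using (_≡_; refl)
open import Function.Bundles using (mk⇔)

⊢⊤ : ⊢ ⊤'
⊢⊤ = taut lemma
  where
  lemma : Tautology ⊤'
  lemma v with v (var 0)
  ... | true  = refl
  ... | false = refl

⇒-refl : ∀ A → ⊢ A ⇒ A
⇒-refl A = taut lemma
  where
  lemma : Tautology (A ⇒ A)
  lemma v with eval v A
  ... | true  = refl
  ... | false = refl

⇔-elimʳ : ∀ {A B} → ⊢ A ⇔' B → ⊢ B → ⊢ A
⇔-elimʳ {A} {B} A⇔B = mp (mp (taut lemma) A⇔B)
  where
  lemma : Tautology ((A ⇔' B) ⇒ (B ⇒ A))
  lemma v with eval v A | eval v B
  ... | true  | true  = refl
  ... | true  | false = refl
  ... | false | true  = refl
  ... | false | false = refl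

contrapose : ∀ {A B} → ⊢ A ⇒ B → ⊢ ~ B → ⊢ ~ A
contrapose {A} {B} A⇒B = mp (mp (taut lemma) A⇒B)
  where
  lemma : Tautology ((A ⇒ B) ⇒ (~ B ⇒ ~ A))
  lemma v with eval v A | eval v B
  ... | true  | true  = refl
  ... | true  | false = refl
  ... | false | true  = refl
  ... | false | false = refl

∧-monoʳ : ∀ A {B C} → ⊢ B ⇒ C → ⊢ (A ∧' B) ⇒ (A ∧' C)
∧-monoʳ A {B} {C} = mp (taut lemma)
  where
  lemma : Tautology ((B ⇒ C) ⇒ ((A ∧' B) ⇒ (A ∧' C)))
  lemma v with eval v A | eval v B | eval v C
  ... | true  | true  | true  = refl
  ... | true  | true  | false = refl
  ... | true  | false | _     = refl
  ... | false | true  | true  = refl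
  ... | false | true  | false = refl
  ... | false | false | _     = refl

∧-introˡ-⇒ : ∀ {T B C} → ⊢ T → ⊢ B ⇒ C → ⊢ B ⇒ (T ∧' C)
∧-introˡ-⇒ {T} {B} {C} ⊢T = mp (mp (taut lemma) ⊢T)
  where
  lemma : Tautology (T ⇒ ((B ⇒ C) ⇒ (B ⇒ (T ∧' C))))
  lemma v with eval v T | eval v B | eval v C
  ... | true  | true  | true  = refl
  ... | true  | true  | false = refl
  ... | true  | false | _     = refl
  ... | false | true  | true  = refl
  ... | false | true  | false = refl
  ... | false | false | _     = refl

⊤∨-⇔-⊤ : ∀ ψ → ⊢ (⊤' ∨' ψ) ⇔' ⊤'
⊤∨-⇔-⊤ ψ = taut lemma
  where
  lemma : Tautology ((⊤' ∨' ψ) ⇔' ⊤')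
  lemma v with v (var 0) | eval v ψ
  ... | true  | true  = refl
  ... | true  | false = refl
  ... | false | true  = refl
  ... | false | false = refl

⊢Δ[⊤∨] : ∀ ψ → ⊢ Δ (⊤' ∨' ψ)
⊢Δ[⊤∨] ψ = ⇔-elimʳ (reΔ (⊤∨-⇔-⊤ ψ)) axN

infixl 5 _⸴_

_⸴_ : FSet → Form → FSet
(Γ ⸴ θ) φ = Γ φ ⊎ φ ≡ θ

drop-theorem : ∀ {Γ θ} → ⊢ θ → (φs : List Form) → All (Γ ⸴ θ) φs →
               Σ (List Form) λ ψs → All Γ ψs × (⊢ conj ψs ⇒ conj φs)
drop-theorem ⊢θ []       []                 = [] , [] , ⇒-refl ⊤'
drop-theorem ⊢θ (φ ∷ φs) (inj₁ φ∈Γ ∷ φs∈)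
  with ψs , ψs∈Γ , ψs⇒φs ← drop-theorem ⊢θ φs φs∈
  = φ ∷ ψs , φ∈Γ ∷ ψs∈Γ , ∧-monoʳ φ ψs⇒φs
drop-theorem ⊢θ (φ ∷ φs) (inj₂ refl ∷ φs∈)
  with ψs , ψs∈Γ , ψs⇒φs ← drop-theorem ⊢θ φs φs∈
  = ψs , ψs∈Γ , ∧-introˡ-⇒ ⊢θ ψs⇒φs

consistent-⸴-theorem : ∀ {Γ θ} → Consistent Γ → ⊢ θ → Consistent (Γ ⸴ θ)
consistent-⸴-theorem con ⊢θ (φs , φs∈ , ⊢¬φs)
  with ψs , ψs∈Γ , ψs⇒φs ← drop-theorem ⊢θ φs φs∈
  = con (ψs , ψs∈Γ , contrapose ψs⇒φs ⊢¬φs)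

maxCons-⊢-closed : ∀ {Γ θ} → MaxCons Γ → ⊢ θ → Γ θ
maxCons-⊢-closed {Γ} {θ} (con , maximal) ⊢θ =
  maximal (Γ ⸴ θ) (λ _ → inj₁) (consistent-⸴-theorem con ⊢θ) θ (inj₂ refl)

∣⊤∣≐Sᶜ : (λ _ → Unit) ≐ ∣ ⊤' ∣
∣⊤∣≐Sᶜ (_ , m) = mk⇔ (λ _ → maxCons-⊢-closed m ⊢⊤) (λ _ → unit)

canonicalModel-hasPropertyN : HasPropertyN canonicalModel
canonicalModel-hasPropertyN (_ , m) = ⊤' , ∣⊤∣≐Sᶜ , λ ψ → maxCons-⊢-closed m (⊢Δ[⊤∨] ψ)

supplementation-hasPropertyN : ∀ M → HasPropertyN M → HasPropertyN (supplementation M)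
supplementation-hasPropertyN M hasN s = (λ _ → Unit) , hasN s , λ _ _ → unit

mainTheorem15 : HasPropertyN canonicalModel × HasPropertyN (supplementation canonicalModel)
mainTheorem15 =
  canonicalModel-hasPropertyN ,
  supplementation-hasPropertyN canonicalModel canonicalModel-hasPropertyN
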